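{- Let $\#$ be a parametrized monad on a category $\mathbf{C}$ with finite coproducts. (i) Suppose $\mathsf{out}_X:\Phi X\to X\#\Phi X$ is a final coalgebra for the functor $X\#(-)$, with inverse $\mathsf{out}_X^{ -1}$. Then $\Phi X$, equipped with the $\#$-algebra structure $\mathsf{out}_X^{ -1}\circ m^{\Phi X}_X\circ(\mathsf{out}_X\#\mathrm{id}_{\Phi X}):\Phi X\#\Phi X\to\Phi X$ and a suitable iteration operator, is a free complete Elgot $\#$-algebra on $X$ with universal morphism $\mathsf{out}_X^{ -1}\circ u^{\Phi X}_X:X\to\Phi X$. (ii) Suppose $\varphi_X:FX\#FX\to FX$ (with some iteration operator) and $\eta_X:X\to FX$ form a free complete Elgot $\#$-algebra on $X$. Then $\varphi_X\circ(\eta_X\#\mathrm{id}_{FX}):X\#FX\to FX$ is an isomorphism, and its inverse is the structure of a final coalgebra for the functor $X\#(-)$.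
   Context: A parametrized monad is a bifunctor $\#:\mathbf{C}\times\mathbf{C}\to\mathbf{C}$ such that each $(-)\#X$ is a monad with unit $u^X_A:A\to A\#X$ and multiplication $m^X_A:(A\#X)\#X\to A\#X$, and for each $f:X\to Y$ the family $(\mathrm{id}_Z\#f)_Z$ is a monad morphism. A $\#$-algebra is $(A,a)$ with $a:A\#A\to A$, $a\circ u^A_A=\mathrm{id}$, $a\circ(a\#\mathrm{id})=a\circ m^A_A$. A complete Elgot $\#$-algebra is a $\#$-algebra $(A,a)$ with an operator sending each $e:X\to A\#X$ to $e^\dagger:X\to A$ such that: (solution) $e^\dagger=a\circ(\mathrm{id}_A\#e^\dagger)\circ e$; (functoriality) for $e:X\to A\#X$, $f:Y\to A\#Y$, $h:X\to Y$, if $f\circ h=(\mathrm{id}_A\#h)\circ e$ then $f^\dagger\circ h=e^\dagger$; (compositionality) for $f:Y\to A\#Y$ and $g:X\to Y\#X$, putting $f^\dagger\bullet g=(f^\dagger\#\mathrm{id}_X)\circ g$ and $f\blacksquare g=m^{Y+X}_A\circ(((\mathrm{id}_A\#\mathsf{inl})\circ f)\#\mathsf{inr})\circ[u^X_Y,g]:Y+X\to A\#(Y+X)$, one has $(f\blacksquare g)^\dagger\circ\mathsf{inr}=(f^\dagger\bullet g)^\dagger$. A morphism of complete Elgot $\#$-algebras $(A,a,\dagger)\to(B,b,\ddagger)$ is $f:A\to B$ with $((f\#\mathrm{id}_X)\circ e)^\ddagger=f\circ e^\dagger$ for all $e:X\to A\#X$. A free complete Elgot $\#$-algebra on $X$ is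 a complete Elgot $\#$-algebra $FX$ with a morphism $\eta_X:X\to FX$ such that for every complete Elgot $\#$-algebra $B$ and every morphism $g:X\to B$ there is a unique morphism of complete Elgot $\#$-algebras $\bar g:FX\to B$ with $\bar g\circ\eta_X=g$. -}

module Defs where

open import Level using (Level; _⊔_) renaming (suc to lsuc)
open import Relation.Binary.PropositionalEquality using (_≡_)
open import Data.Product using (Σ; _×_)

record Category (o ℓ : Level) : Set (lsuc (o ⊔ ℓ)) where
  infixr 9 _∘_
  field
    Obj : Set o
    Hom : Obj → Obj → Set ℓ
    id  : ∀ {A} → Hom A A
    _∘_ : ∀ {A B C} → Hom B C → Hom A B → Hom A C
    identityˡ : ∀ {A B} {f : Hom A B} → id ∘ f ≡ f
    identityʳ : ∀ {A B} {f : Hom A B} → f ∘ id ≡ f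
    assoc : ∀ {A B C D} {f : Hom A B} {g : Hom B C} {h : Hom C D} →
            (h ∘ g) ∘ f ≡ h ∘ (g ∘ f)

record FiniteCoproducts {o ℓ} (C : Category o ℓ) : Set (o ⊔ ℓ) where
  open Category C
  infixr 6 _+_
  field
    𝟘 : Obj
    ¡ : ∀ {A} → Hom 𝟘 A
    ¡-unique : ∀ {A} (f : Hom 𝟘 A) → f ≡ ¡
    _+_ : Obj → Obj → Obj
    inl : ∀ {A B} → Hom A (A + B)
    inr : ∀ {A B} → Hom B (A + B)
    [_,_] : ∀ {A B Z} → Hom A Z → Hom B Z → Hom (A + B) Z
    inl-β : ∀ {A B Z} {f : Hom A Z} {g : Hom B Z} → [ f , g ] ∘ inl ≡ f
    inr-β : ∀ {A B Z} {f : Hom A Z} {g : Hom B Z} → [ f , g ] ∘ inr ≡ g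
    +-unique : ∀ {A B Z} {f : Hom A Z} {g : Hom B Z} (h : Hom (A + B) Z) →
               h ∘ inl ≡ f → h ∘ inr ≡ g → h ≡ [ f , g ]

-- A parametrized monad: a bifunctor _#_ such that each (-) # X is a monad
-- (unit u X A : A → A # X, multiplication m X A : (A # X) # X → A # X)
-- and for each f : X → Y, (id_Z # f)_Z is a monad morphism.
record ParametrizedMonad {o ℓ} (C : Category o ℓ) : Set (o ⊔ ℓ) where
  open Category C
  infixl 7 _#_ _#₁_
  field
    _#_  : Obj → Obj → Obj
    _#₁_ : ∀ {A B X Y} → Hom A B → Hom X Y → Hom (A # X) (B # Y)
    #-id : ∀ {A X} → id {A} #₁ id {X} ≡ id
    #-∘  : ∀ {A B D X Y Z} {f : Hom B D} {f' : Hom A B} {g : Hom Y Z} {g' : Hom X Y} →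
           (f ∘ f') #₁ (g ∘ g') ≡ (f #₁ g) ∘ (f' #₁ g')
    u : ∀ X A → Hom A (A # X)
    m : ∀ X A → Hom ((A # X) # X) (A # X)
    u-natural : ∀ {X A B} (f : Hom A B) → (f #₁ id {X}) ∘ u X A ≡ u X B ∘ f
    m-natural : ∀ {X A B} (f : Hom A B) →
                (f #₁ id {X}) ∘ m X A ≡ m X B ∘ ((f #₁ id) #₁ id)
    m-identityˡ : ∀ {X A} → m X A ∘ u X (A # X) ≡ id
    m-identityʳ : ∀ {X A} → m X A ∘ (u X A #₁ id) ≡ id
    m-assoc : ∀ {X A} → m X A ∘ (m X A #₁ id) ≡ m X A ∘ m X (A # X)
    mm-unit : ∀ {X Y Z} (f : Hom X Y) → (id {Z} #₁ f) ∘ u X Z ≡ u Y Z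
    mm-mult : ∀ {X Y Z} (f : Hom X Y) →
              (id {Z} #₁ f) ∘ m X Z ≡ m Y Z ∘ ((id #₁ f) #₁ f)

module Theory {o ℓ} (C : Category o ℓ) (CP : FiniteCoproducts C)
              (P : ParametrizedMonad C) where
  open Category C
  open FiniteCoproducts CP
  open ParametrizedMonad P

  record IsAlgebra (A : Obj) (a : Hom (A # A) A) : Set ℓ where
    field
      alg-unit : a ∘ u A A ≡ id
      alg-mult : a ∘ (a #₁ id) ≡ a ∘ m A A

  _■_ : ∀ {A X Y} → Hom Y (A # Y) → Hom X (Y # X) → Hom (Y + X) (A # (Y + X))
  _■_ {A} {X} {Y} f g = m (Y + X) A ∘ (((id #₁ inl) ∘ f) #₁ inr) ∘ [ u X Y , g ]

  record IsCompleteElgot (A : Obj) (a : Hom (A # A) A) : Set (o ⊔ ℓ) where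
    field
      isAlgebra : IsAlgebra A a
      _† : ∀ {X} → Hom X (A # X) → Hom X A
      solution : ∀ {X} (e : Hom X (A # X)) → e † ≡ a ∘ (id #₁ (e †)) ∘ e
      functoriality : ∀ {X Y} (e : Hom X (A # X)) (f : Hom Y (A # Y)) (h : Hom X Y) →
                      f ∘ h ≡ (id #₁ h) ∘ e → (f †) ∘ h ≡ e †
      compositionality : ∀ {X Y} (f : Hom Y (A # Y)) (g : Hom X (Y # X)) →
                         ((f ■ g) †) ∘ inr ≡ (((f †) #₁ id) ∘ g) †

  record CompleteElgotAlgebra : Set (o ⊔ ℓ) where
    constructor cea
    field
      Carrier : Obj
      structure : Hom (Carrier # Carrier) Carrier
      isCompleteElgot : IsCompleteElgot Carrier structure
    open IsCompleteElgot isCompleteElgot public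

  open CompleteElgotAlgebra

  IsCEAMorphism : (A B : CompleteElgotAlgebra) → Hom (Carrier A) (Carrier B) → Set (o ⊔ ℓ)
  IsCEAMorphism A B f = ∀ {X} (e : Hom X (Carrier A # X)) →
    _†_ B ((f #₁ id) ∘ e) ≡ f ∘ _†_ A e
    where _†_ : (E : CompleteElgotAlgebra) → ∀ {X} → Hom X (Carrier E # X) → Hom X (Carrier E)
          _†_ E = IsCompleteElgot._† (isCompleteElgot E)

  IsFreeCEA : (X : Obj) (F : CompleteElgotAlgebra) (η : Hom X (Carrier F)) → Set (o ⊔ ℓ)
  IsFreeCEA X F η = ∀ (B : CompleteElgotAlgebra) (g : Hom X (Carrier B)) →
    Σ (Hom (Carrier F) (Carrier B)) λ h →
      IsCEAMorphism F B h × h ∘ η ≡ g ×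
      (∀ (h' : Hom (Carrier F) (Carrier B)) → IsCEAMorphism F B h' → h' ∘ η ≡ g → h' ≡ h)

  IsFinalCoalgebra : (X Φ : Obj) (out : Hom Φ (X # Φ)) → Set (o ⊔ ℓ)
  IsFinalCoalgebra X Φ out = ∀ {D : Obj} (c : Hom D (X # D)) →
    Σ (Hom D Φ) λ h → out ∘ h ≡ (id #₁ h) ∘ c ×
      (∀ (h' : Hom D Φ) → out ∘ h' ≡ (id #₁ h') ∘ c → h' ≡ h)

-- (i) A final coalgebra gives unique solutions: the solution of e : Y → Φ # Y is read off
-- the unique coalgebra map from out ■ e to out, and uniqueness yields all Elgot laws. The
-- extension of g : X → B is the B-solution of (g # id) ∘ out; it is unique because the
-- identity of Φ is the solution of (η # id) ∘ out.
-- (ii) For any complete Elgot algebra A and h : X → A, X # A is again one, with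
-- ψ = a ∘ (h # id) a morphism back to A. Freeness gives i : FX → X # FX extending u, and
-- again (endomorphisms fixing η are the identity) i is inverse to ψ = φ ∘ (η # id). The
-- coalgebra maps c → i are the solutions of (η # id) ∘ c: ((η # id) ∘ i) † is an
-- endomorphism fixing η, hence the identity, and functoriality does the rest.

module Submission where

open import Defs
open import Relation.Binary.PropositionalEquality using (_≡_; refl; sym; trans; cong; cong₂; module ≡-Reasoning)
open import Data.Product using (Σ; _×_; _,_; proj₁; proj₂)

module Elgot {o ℓ} (C : Category o ℓ) (CP : FiniteCoproducts C) (P : ParametrizedMonad C) where
  open Category C
  open FiniteCoproducts CP
  open ParametrizedMonad P
  open Theory C CP P
  open ≡-Reasoning

  private variable
    A B D W X Y Z : Obj

  infixr 4 _⟩∘⟨_ _⟩#⟨_ refl⟩∘⟨_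
  infixl 5 _⟩∘⟨refl

  _⟩∘⟨_ : {f f' : Hom B W} {g g' : Hom A B} → f ≡ f' → g ≡ g' → f ∘ g ≡ f' ∘ g'
  _⟩∘⟨_ = cong₂ _∘_

  refl⟩∘⟨_ : {f : Hom B W} {g g' : Hom A B} → g ≡ g' → f ∘ g ≡ f ∘ g'
  refl⟩∘⟨_ {f = f} = cong (f ∘_)

  _⟩∘⟨refl : {f f' : Hom B W} {g : Hom A B} → f ≡ f' → f ∘ g ≡ f' ∘ g
  _⟩∘⟨refl {g = g} = cong (_∘ g)

  _⟩#⟨_ : {f f' : Hom A B} {g g' : Hom X Y} → f ≡ f' → g ≡ g' → f #₁ g ≡ f' #₁ g'
  _⟩#⟨_ = cong₂ _#₁_

  pullʳ : {f : Hom B W} {g : Hom A B} {h : Hom D A} {i : Hom D B} →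
          g ∘ h ≡ i → (f ∘ g) ∘ h ≡ f ∘ i
  pullʳ eq = trans assoc (refl⟩∘⟨ eq)

  pullˡ : {f : Hom B W} {g : Hom A B} {h : Hom D A} {i : Hom A W} →
          f ∘ g ≡ i → f ∘ g ∘ h ≡ i ∘ h
  pullˡ eq = trans (sym assoc) (eq ⟩∘⟨refl)

  cancelˡ : {f : Hom B A} {g : Hom A B} {h : Hom D A} → f ∘ g ≡ id → f ∘ g ∘ h ≡ h
  cancelˡ eq = trans (pullˡ eq) identityˡ

  leftInverse⇒mono : {f : Hom A B} {f⁻¹ : Hom B A} {g h : Hom D A} →
             f⁻¹ ∘ f ≡ id → f ∘ g ≡ f ∘ h → g ≡ h
  leftInverse⇒mono {f = f} {f⁻¹} {g} {h} inv eq = begin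
    g            ≡⟨ cancelˡ inv ⟨
    f⁻¹ ∘ f ∘ g  ≡⟨ refl⟩∘⟨ eq ⟩
    f⁻¹ ∘ f ∘ h  ≡⟨ cancelˡ inv ⟩
    h            ∎

  +-ext : {f g : Hom (A + B) Z} → f ∘ inl ≡ g ∘ inl → f ∘ inr ≡ g ∘ inr → f ≡ g
  +-ext {f = f} {g} p q = trans (+-unique f p q) (sym (+-unique g refl refl))

  #-merge : {f : Hom B D} {f' : Hom A B} {g : Hom Y Z} {g' : Hom X Y} →
            (f #₁ g) ∘ (f' #₁ g') ≡ (f ∘ f') #₁ (g ∘ g')
  #-merge = sym #-∘

  #-mergeˡ : {f : Hom B D} {f' : Hom A B} → (f #₁ id {X}) ∘ (f' #₁ id) ≡ (f ∘ f') #₁ id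
  #-mergeˡ = trans #-merge (refl ⟩#⟨ identityˡ)

  #-mergeʳ : {g : Hom Y Z} {g' : Hom X Y} → (id {A} #₁ g) ∘ (id #₁ g') ≡ id #₁ (g ∘ g')
  #-mergeʳ = trans #-merge (identityˡ ⟩#⟨ refl)

  #-splitˡ : {f : Hom A B} {g : Hom X Y} → f #₁ g ≡ (f #₁ id) ∘ (id #₁ g)
  #-splitˡ = trans (sym identityʳ ⟩#⟨ sym identityˡ) #-∘

  #-splitʳ : {f : Hom A B} {g : Hom X Y} → f #₁ g ≡ (id #₁ g) ∘ (f #₁ id)
  #-splitʳ = trans (sym identityˡ ⟩#⟨ sym identityʳ) #-∘

  #-swap : {f : Hom A B} {g : Hom X Y} → (f #₁ id) ∘ (id #₁ g) ≡ (id #₁ g) ∘ (f #₁ id)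
  #-swap = trans (sym #-splitˡ) #-splitʳ

  #-identity∘ : {f : Hom A (B # X)} → (id #₁ id) ∘ f ≡ f
  #-identity∘ = trans (#-id ⟩∘⟨refl) identityˡ

  IsCoalgebraHom : Hom X (A # X) → Hom Y (A # Y) → Hom X Y → Set ℓ
  IsCoalgebraHom e f h = f ∘ h ≡ (id #₁ h) ∘ e

  relabel-coalgebraHom : (p : Hom A B) {e : Hom X (A # X)} {f : Hom Y (A # Y)} {h : Hom X Y} →
    IsCoalgebraHom e f h → IsCoalgebraHom ((p #₁ id) ∘ e) ((p #₁ id) ∘ f) h
  relabel-coalgebraHom p {e} {f} {h} hom = begin
    ((p #₁ id) ∘ f) ∘ h            ≡⟨ pullʳ hom ⟩
    (p #₁ id) ∘ (id #₁ h) ∘ e      ≡⟨ pullˡ #-swap ⟩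
    ((id #₁ h) ∘ (p #₁ id)) ∘ e    ≡⟨ assoc ⟩
    (id #₁ h) ∘ (p #₁ id) ∘ e      ∎

  ■-inl : (f : Hom Y (A # Y)) (g : Hom X (Y # X)) → IsCoalgebraHom f (f ■ g) inl
  ■-inl {Y} {A} {X} f g = begin
    (m (Y + X) A ∘ (((id #₁ inl) ∘ f) #₁ inr) ∘ [ u X Y , g ]) ∘ inl
      ≡⟨ pullʳ (pullʳ inl-β) ⟩
    m (Y + X) A ∘ (((id #₁ inl) ∘ f) #₁ inr) ∘ u X Y
      ≡⟨ refl⟩∘⟨ #-splitˡ ⟩∘⟨refl ⟩
    m (Y + X) A ∘ ((((id #₁ inl) ∘ f) #₁ id) ∘ (id #₁ inr)) ∘ u X Y
      ≡⟨ refl⟩∘⟨ pullʳ (mm-unit inr) ⟩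
    m (Y + X) A ∘ (((id #₁ inl) ∘ f) #₁ id) ∘ u (Y + X) Y
      ≡⟨ refl⟩∘⟨ u-natural _ ⟩
    m (Y + X) A ∘ u (Y + X) (A # (Y + X)) ∘ (id #₁ inl) ∘ f
      ≡⟨ cancelˡ m-identityˡ ⟩
    (id #₁ inl) ∘ f
      ∎

  ■-inr : (f : Hom Y (A # Y)) (g : Hom X (Y # X)) (s : Hom (Y + X) Z) →
          (id #₁ s) ∘ (f ■ g) ∘ inr ≡ m Z A ∘ (((id #₁ (s ∘ inl)) ∘ f) #₁ (s ∘ inr)) ∘ g
  ■-inr {Y} {A} {X} f g s = begin
    (id #₁ s) ∘ (m (Y + X) A ∘ (((id #₁ inl) ∘ f) #₁ inr) ∘ [ u X Y , g ]) ∘ inr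
      ≡⟨ refl⟩∘⟨ pullʳ (pullʳ inr-β) ⟩
    (id #₁ s) ∘ m (Y + X) A ∘ (((id #₁ inl) ∘ f) #₁ inr) ∘ g
      ≡⟨ pullˡ (mm-mult s) ⟩
    (m _ A ∘ ((id #₁ s) #₁ s)) ∘ (((id #₁ inl) ∘ f) #₁ inr) ∘ g
      ≡⟨ pullʳ (pullˡ #-merge) ⟩
    m _ A ∘ (((id #₁ s) ∘ (id #₁ inl) ∘ f) #₁ (s ∘ inr)) ∘ g
      ≡⟨ refl⟩∘⟨ (pullˡ #-mergeʳ ⟩#⟨ refl) ⟩∘⟨refl ⟩
    m _ A ∘ (((id #₁ (s ∘ inl)) ∘ f) #₁ (s ∘ inr)) ∘ g
      ∎

  ■-natural : (p : Hom A B) (f : Hom Y (A # Y)) (g : Hom X (Y # X)) →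
              (p #₁ id) ∘ (f ■ g) ≡ ((p #₁ id) ∘ f) ■ g
  ■-natural {A} {B} {Y} {X} p f g = begin
    (p #₁ id) ∘ m (Y + X) A ∘ (((id #₁ inl) ∘ f) #₁ inr) ∘ [ u X Y , g ]
      ≡⟨ pullˡ (m-natural p) ⟩
    (m (Y + X) B ∘ ((p #₁ id) #₁ id)) ∘ (((id #₁ inl) ∘ f) #₁ inr) ∘ [ u X Y , g ]
      ≡⟨ pullʳ (pullˡ #-merge) ⟩
    m (Y + X) B ∘ (((p #₁ id) ∘ (id #₁ inl) ∘ f) #₁ (id ∘ inr)) ∘ [ u X Y , g ]
      ≡⟨ refl⟩∘⟨ (trans (pullˡ #-swap) assoc ⟩#⟨ identityˡ) ⟩∘⟨refl ⟩
    m (Y + X) B ∘ (((id #₁ inl) ∘ (p #₁ id) ∘ f) #₁ inr) ∘ [ u X Y , g ]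
      ∎

  ■-copair : (f : Hom Y (A # Y)) (g : Hom X (Y # X)) (s : Hom X Y) →
             f ∘ s ≡ m Y A ∘ (f #₁ s) ∘ g → IsCoalgebraHom (f ■ g) f [ id , s ]
  ■-copair {Y} {A} {X} f g s eq = +-ext on-inl on-inr
    where
    k : Hom (Y + X) Y
    k = [ id , s ]

    on-inl : (f ∘ k) ∘ inl ≡ ((id #₁ k) ∘ (f ■ g)) ∘ inl
    on-inl = begin
      (f ∘ k) ∘ inl               ≡⟨ trans (pullʳ inl-β) identityʳ ⟩
      f                           ≡⟨ #-identity∘ ⟨
      (id #₁ id) ∘ f              ≡⟨ (refl ⟩#⟨ inl-β) ⟩∘⟨refl ⟨
      (id #₁ (k ∘ inl)) ∘ f       ≡⟨ pullˡ #-mergeʳ ⟨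
      (id #₁ k) ∘ (id #₁ inl) ∘ f ≡⟨ pullʳ (■-inl f g) ⟨
      ((id #₁ k) ∘ (f ■ g)) ∘ inl ∎

    on-inr : (f ∘ k) ∘ inr ≡ ((id #₁ k) ∘ (f ■ g)) ∘ inr
    on-inr = begin
      (f ∘ k) ∘ inr
        ≡⟨ pullʳ inr-β ⟩
      f ∘ s
        ≡⟨ eq ⟩
      m Y A ∘ (f #₁ s) ∘ g
        ≡⟨ refl⟩∘⟨ (trans ((refl ⟩#⟨ inl-β) ⟩∘⟨refl) #-identity∘ ⟩#⟨ inr-β) ⟩∘⟨refl ⟨
      m Y A ∘ (((id #₁ (k ∘ inl)) ∘ f) #₁ (k ∘ inr)) ∘ g
        ≡⟨ ■-inr f g k ⟨
      (id #₁ k) ∘ (f ■ g) ∘ inr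
        ≡⟨ assoc ⟨
      ((id #₁ k) ∘ (f ■ g)) ∘ inr
        ∎

  module CompleteElgotFacts {A : Obj} {a : Hom (A # A) A} (E : IsCompleteElgot A a) where
    open IsCompleteElgot E
    open IsAlgebra isAlgebra

    †-unit : (k : Hom Y A) → (u Y A ∘ k) † ≡ k
    †-unit {Y} k = begin
      (u Y A ∘ k) †                               ≡⟨ solution _ ⟩
      a ∘ (id #₁ ((u Y A ∘ k) †)) ∘ u Y A ∘ k     ≡⟨ refl⟩∘⟨ pullˡ (mm-unit _) ⟩
      a ∘ u A A ∘ k                               ≡⟨ cancelˡ alg-unit ⟩
      k                                           ∎

    †-■-inl : (f : Hom Y (A # Y)) (g : Hom X (Y # X)) → ((f ■ g) †) ∘ inl ≡ f †
    †-■-inl f g = functoriality f (f ■ g) inl (■-inl f g)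

    structure≡† : a ≡ (id #₁ u A A) †
    structure≡† = sym (begin
      (id #₁ u A A) †                                  ≡⟨ solution _ ⟩
      a ∘ (id #₁ ((id #₁ u A A) †)) ∘ (id #₁ u A A)    ≡⟨ refl⟩∘⟨ #-mergeʳ ⟩
      a ∘ (id #₁ (((id #₁ u A A) †) ∘ u A A))          ≡⟨ refl⟩∘⟨ (refl ⟩#⟨ †∘u) ⟩
      a ∘ (id #₁ id)                                   ≡⟨ trans (refl⟩∘⟨ #-id) identityʳ ⟩
      a                                                ∎)
      where
      †∘u : ((id #₁ u A A) †) ∘ u A A ≡ id
      †∘u = begin
        ((id #₁ u A A) †) ∘ u A A   ≡⟨ functoriality (u A A) (id #₁ u A A) (u A A) refl ⟩
        (u A A) †                   ≡⟨ cong _† identityʳ ⟨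
        (u A A ∘ id) †              ≡⟨ †-unit id ⟩
        id                          ∎

    †-endomorphism : (e : Hom A (A # A)) →
      (∀ {Y} (f : Hom Y (A # Y)) → e ∘ (f †) ≡ m A A ∘ (e #₁ (f †)) ∘ f) →
      ∀ {Y} (f : Hom Y (A # Y)) → (((e †) #₁ id) ∘ f) † ≡ (e †) ∘ (f †)
    †-endomorphism e iterate f = begin
      (((e †) #₁ id) ∘ f) †
        ≡⟨ compositionality e f ⟨
      ((e ■ f) †) ∘ inr
        ≡⟨ functoriality (e ■ f) e [ id , f † ] (■-copair e f (f †) (iterate f)) ⟩∘⟨refl ⟨
      ((e †) ∘ [ id , f † ]) ∘ inr
        ≡⟨ pullʳ inr-β ⟩
      (e †) ∘ (f †)
        ∎

  open CompleteElgotAlgebra using (Carrier; structure)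

  id-isCEAMorphism : (F : CompleteElgotAlgebra) → IsCEAMorphism F F id
  id-isCEAMorphism F e = trans (cong F._† #-identity∘) (sym identityˡ)
    where module F = CompleteElgotAlgebra F

  ∘-isCEAMorphism : (F G H : CompleteElgotAlgebra)
                    {h : Hom (Carrier F) (Carrier G)} {k : Hom (Carrier G) (Carrier H)} →
                    IsCEAMorphism F G h → IsCEAMorphism G H k → IsCEAMorphism F H (k ∘ h)
  ∘-isCEAMorphism F G H {h} {k} h-mor k-mor e = begin
    (((k ∘ h) #₁ id) ∘ e) H.†         ≡⟨ cong H._† (trans (sym #-mergeˡ ⟩∘⟨refl) assoc) ⟩
    ((k #₁ id) ∘ (h #₁ id) ∘ e) H.†   ≡⟨ k-mor _ ⟩
    k ∘ (((h #₁ id) ∘ e) G.†)         ≡⟨ refl⟩∘⟨ h-mor e ⟩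
    k ∘ h ∘ (e F.†)                   ≡⟨ assoc ⟨
    (k ∘ h) ∘ (e F.†)                 ∎
    where
    module F = CompleteElgotAlgebra F
    module G = CompleteElgotAlgebra G
    module H = CompleteElgotAlgebra H

  isCEAMorphism⇒algebraHom : {A : Obj} {a : Hom (A # A) A} (E : IsCompleteElgot A a)
    (B : CompleteElgotAlgebra) (h : Hom A (Carrier B)) →
    IsCEAMorphism (cea A a E) B h → h ∘ a ≡ structure B ∘ (h #₁ h)
  isCEAMorphism⇒algebraHom {A} {a} E B h h-mor = begin
    h ∘ a
      ≡⟨ refl⟩∘⟨ CompleteElgotFacts.structure≡† E ⟩
    h ∘ IsCompleteElgot._† E (id #₁ u A A)
      ≡⟨ h-mor _ ⟨
    ((h #₁ id) ∘ (id #₁ u A A)) B.†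
      ≡⟨ cong B._† #-splitˡ ⟨
    (h #₁ u A A) B.†
      ≡⟨ B.solution _ ⟩
    B.structure ∘ (id #₁ ((h #₁ u A A) B.†)) ∘ (h #₁ u A A)
      ≡⟨ refl⟩∘⟨ #-merge ⟩
    B.structure ∘ ((id ∘ h) #₁ (((h #₁ u A A) B.†) ∘ u A A))
      ≡⟨ refl⟩∘⟨ (identityˡ ⟩#⟨ †∘u) ⟩
    B.structure ∘ (h #₁ h)
      ∎
    where
    module B = CompleteElgotAlgebra B

    u∘h-hom : IsCoalgebraHom (u A B.Carrier ∘ h) (h #₁ u A A) (u A A)
    u∘h-hom = begin
      (h #₁ u A A) ∘ u A A                    ≡⟨ #-splitˡ ⟩∘⟨refl ⟩
      ((h #₁ id) ∘ (id #₁ u A A)) ∘ u A A     ≡⟨ pullʳ (mm-unit (u A A)) ⟩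
      (h #₁ id) ∘ u (A # A) A                 ≡⟨ u-natural h ⟩
      u (A # A) B.Carrier ∘ h                 ≡⟨ pullˡ (mm-unit (u A A)) ⟨
      (id #₁ u A A) ∘ u A B.Carrier ∘ h       ∎

    †∘u : ((h #₁ u A A) B.†) ∘ u A A ≡ h
    †∘u = trans (B.functoriality _ _ _ u∘h-hom) (CompleteElgotFacts.†-unit B.isCompleteElgot h)

  free-endo≡id : (F : CompleteElgotAlgebra) {X : Obj} {η : Hom X (Carrier F)} → IsFreeCEA X F η →
                 (h : Hom (Carrier F) (Carrier F)) → IsCEAMorphism F F h → h ∘ η ≡ η → h ≡ id
  free-endo≡id F {η = η} free h h-mor h∘η =
    trans (unique h h-mor h∘η) (sym (unique id (id-isCEAMorphism F) identityˡ))
    where unique = proj₂ (proj₂ (proj₂ (free F η)))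

  module Lifted {A X : Obj} {a : Hom (A # A) A} (E : IsCompleteElgot A a) (h : Hom X A) where
    open IsCompleteElgot E
    open IsAlgebra isAlgebra

    ψ : Hom (X # A) A
    ψ = a ∘ (h #₁ id)

    lifted : Hom ((X # A) # (X # A)) (X # A)
    lifted = m A X ∘ (id #₁ ψ)

    _‡ : Hom Y ((X # A) # Y) → Hom Y (X # A)
    e ‡ = m A X ∘ (id #₁ (((ψ #₁ id) ∘ e) †)) ∘ e

    ψ∘u : ψ ∘ u A X ≡ h
    ψ∘u = trans (pullʳ (u-natural h)) (cancelˡ alg-unit)

    ψ∘m : ψ ∘ m A X ≡ a ∘ (ψ #₁ id)
    ψ∘m = begin
      (a ∘ (h #₁ id)) ∘ m A X           ≡⟨ pullʳ (m-natural h) ⟩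
      a ∘ m A A ∘ ((h #₁ id) #₁ id)     ≡⟨ pullˡ (sym alg-mult) ⟩
      (a ∘ (a #₁ id)) ∘ ((h #₁ id) #₁ id) ≡⟨ pullʳ #-mergeˡ ⟩
      a ∘ (ψ #₁ id)                     ∎

    ψ∘‡ : (e : Hom Y ((X # A) # Y)) → ψ ∘ (e ‡) ≡ ((ψ #₁ id) ∘ e) †
    ψ∘‡ e = begin
      ψ ∘ m A X ∘ (id #₁ (((ψ #₁ id) ∘ e) †)) ∘ e     ≡⟨ pullˡ ψ∘m ⟩
      (a ∘ (ψ #₁ id)) ∘ (id #₁ (((ψ #₁ id) ∘ e) †)) ∘ e ≡⟨ pullʳ (pullˡ #-swap) ⟩
      a ∘ ((id #₁ (((ψ #₁ id) ∘ e) †)) ∘ (ψ #₁ id)) ∘ e ≡⟨ refl⟩∘⟨ assoc ⟩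
      a ∘ (id #₁ (((ψ #₁ id) ∘ e) †)) ∘ (ψ #₁ id) ∘ e   ≡⟨ solution _ ⟨
      ((ψ #₁ id) ∘ e) †                                 ∎

    ‡-solution : (e : Hom Y ((X # A) # Y)) → e ‡ ≡ lifted ∘ (id #₁ (e ‡)) ∘ e
    ‡-solution e = sym (begin
      (m A X ∘ (id #₁ ψ)) ∘ (id #₁ (e ‡)) ∘ e    ≡⟨ pullʳ (pullˡ #-mergeʳ) ⟩
      m A X ∘ (id #₁ (ψ ∘ (e ‡))) ∘ e            ≡⟨ refl⟩∘⟨ (refl ⟩#⟨ ψ∘‡ e) ⟩∘⟨refl ⟩
      e ‡                                        ∎)

    lifted-unit : lifted ∘ u (X # A) (X # A) ≡ id
    lifted-unit = trans (pullʳ (mm-unit ψ)) m-identityˡ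

    lifted-mult : lifted ∘ (lifted #₁ id) ≡ lifted ∘ m (X # A) (X # A)
    lifted-mult = begin
      (m A X ∘ (id #₁ ψ)) ∘ (lifted #₁ id)           ≡⟨ pullʳ (trans #-merge (identityˡ ⟩#⟨ identityʳ)) ⟩
      m A X ∘ ((m A X ∘ (id #₁ ψ)) #₁ ψ)             ≡⟨ refl⟩∘⟨ trans (refl ⟩#⟨ sym identityˡ) #-∘ ⟩
      m A X ∘ (m A X #₁ id) ∘ ((id #₁ ψ) #₁ ψ)       ≡⟨ pullˡ m-assoc ⟩
      (m A X ∘ m A (X # A)) ∘ ((id #₁ ψ) #₁ ψ)       ≡⟨ pullʳ (sym (mm-mult ψ)) ⟩
      m A X ∘ (id #₁ ψ) ∘ m (X # A) (X # A)          ≡⟨ assoc ⟨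
      lifted ∘ m (X # A) (X # A)                     ∎

    ‡-functoriality : (e : Hom Y ((X # A) # Y)) (f : Hom Z ((X # A) # Z)) (k : Hom Y Z) →
                      IsCoalgebraHom e f k → (f ‡) ∘ k ≡ e ‡
    ‡-functoriality e f k hom = begin
      (m A X ∘ (id #₁ (((ψ #₁ id) ∘ f) †)) ∘ f) ∘ k        ≡⟨ pullʳ (pullʳ hom) ⟩
      m A X ∘ (id #₁ (((ψ #₁ id) ∘ f) †)) ∘ (id #₁ k) ∘ e  ≡⟨ refl⟩∘⟨ pullˡ #-mergeʳ ⟩
      m A X ∘ (id #₁ ((((ψ #₁ id) ∘ f) †) ∘ k)) ∘ e        ≡⟨ refl⟩∘⟨ (refl ⟩#⟨ ψ-hom) ⟩∘⟨refl ⟩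
      e ‡                                                  ∎
      where
      ψ-hom : (((ψ #₁ id) ∘ f) †) ∘ k ≡ ((ψ #₁ id) ∘ e) †
      ψ-hom = functoriality _ _ k (relabel-coalgebraHom ψ hom)

    ‡-compositionality : (f : Hom Y ((X # A) # Y)) (g : Hom Z (Y # Z)) →
                         ((f ■ g) ‡) ∘ inr ≡ (((f ‡) #₁ id) ∘ g) ‡
    ‡-compositionality {Y} {Z} f g = begin
      (m A X ∘ (id #₁ S) ∘ (f ■ g)) ∘ inr
        ≡⟨ pullʳ assoc ⟩
      m A X ∘ (id #₁ S) ∘ (f ■ g) ∘ inr
        ≡⟨ refl⟩∘⟨ ■-inr f g S ⟩
      m A X ∘ m A (X # A) ∘ (((id #₁ (S ∘ inl)) ∘ f) #₁ (S ∘ inr)) ∘ g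
        ≡⟨ pullˡ (sym m-assoc) ⟩
      (m A X ∘ (m A X #₁ id)) ∘ (((id #₁ (S ∘ inl)) ∘ f) #₁ (S ∘ inr)) ∘ g
        ≡⟨ pullʳ (pullˡ (trans #-merge (refl ⟩#⟨ identityˡ))) ⟩
      m A X ∘ ((m A X ∘ (id #₁ (S ∘ inl)) ∘ f) #₁ (S ∘ inr)) ∘ g
        ≡⟨ refl⟩∘⟨ ((refl⟩∘⟨ (refl ⟩#⟨ S∘inl) ⟩∘⟨refl) ⟩#⟨ S∘inr) ⟩∘⟨refl ⟩
      m A X ∘ ((f ‡) #₁ Q) ∘ g
        ≡⟨ refl⟩∘⟨ pullˡ (sym #-splitʳ) ⟨
      m A X ∘ (id #₁ Q) ∘ ((f ‡) #₁ id) ∘ g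
        ≡⟨ refl⟩∘⟨ (refl ⟩#⟨ cong _† ψ-image) ⟩∘⟨refl ⟨
      (((f ‡) #₁ id) ∘ g) ‡
        ∎
      where
      S : Hom (Y + Z) A
      S = ((ψ #₁ id) ∘ (f ■ g)) †

      Q : Hom Z A
      Q = ((((ψ #₁ id) ∘ f) † #₁ id) ∘ g) †

      S≡ : S ≡ (((ψ #₁ id) ∘ f) ■ g) †
      S≡ = cong _† (■-natural ψ f g)

      S∘inl : S ∘ inl ≡ ((ψ #₁ id) ∘ f) †
      S∘inl = trans (S≡ ⟩∘⟨refl) (CompleteElgotFacts.†-■-inl E _ g)

      S∘inr : S ∘ inr ≡ Q
      S∘inr = trans (S≡ ⟩∘⟨refl) (compositionality _ g)

      ψ-image : (ψ #₁ id) ∘ ((f ‡) #₁ id) ∘ g ≡ ((((ψ #₁ id) ∘ f) †) #₁ id) ∘ g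
      ψ-image = trans (pullˡ #-mergeˡ) ((ψ∘‡ f ⟩#⟨ refl) ⟩∘⟨refl)

    isCompleteElgot : IsCompleteElgot (X # A) lifted
    isCompleteElgot = record
      { isAlgebra = record { alg-unit = lifted-unit ; alg-mult = lifted-mult }
      ; _† = _‡
      ; solution = ‡-solution
      ; functoriality = ‡-functoriality
      ; compositionality = ‡-compositionality
      }

    algebra : CompleteElgotAlgebra
    algebra = cea (X # A) lifted isCompleteElgot

    ψ-isCEAMorphism : IsCEAMorphism algebra (cea A a E) ψ
    ψ-isCEAMorphism e = sym (ψ∘‡ e)

  module FinalCoalgebra (X Φ : Obj) (out : Hom Φ (X # Φ)) (out⁻¹ : Hom (X # Φ) Φ)
                        (out⁻¹∘out : out⁻¹ ∘ out ≡ id) (out∘out⁻¹ : out ∘ out⁻¹ ≡ id)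
                        (final : IsFinalCoalgebra X Φ out) where

    φ : Hom (Φ # Φ) Φ
    φ = out⁻¹ ∘ m Φ X ∘ (out #₁ id)

    ⟦_⟧ : Hom D (X # D) → Hom D Φ
    ⟦ c ⟧ = proj₁ (final c)

    ⟦⟧-hom : (c : Hom D (X # D)) → IsCoalgebraHom c out ⟦ c ⟧
    ⟦⟧-hom c = proj₁ (proj₂ (final c))

    ⟦⟧-unique : (c : Hom D (X # D)) (h : Hom D Φ) → IsCoalgebraHom c out h → h ≡ ⟦ c ⟧
    ⟦⟧-unique c = proj₂ (proj₂ (final c))

    endo≡id : (h : Hom Φ Φ) → IsCoalgebraHom out out h → h ≡ id
    endo≡id h hom =
      trans (⟦⟧-unique out h hom) (sym (⟦⟧-unique out id (trans identityʳ (sym #-identity∘))))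

    out∘φ : out ∘ φ ≡ m Φ X ∘ (out #₁ id)
    out∘φ = cancelˡ out∘out⁻¹

    φ-unit : φ ∘ u Φ Φ ≡ id
    φ-unit = begin
      (out⁻¹ ∘ m Φ X ∘ (out #₁ id)) ∘ u Φ Φ   ≡⟨ pullʳ (pullʳ (u-natural out)) ⟩
      out⁻¹ ∘ m Φ X ∘ u Φ (X # Φ) ∘ out       ≡⟨ refl⟩∘⟨ cancelˡ m-identityˡ ⟩
      out⁻¹ ∘ out                             ≡⟨ out⁻¹∘out ⟩
      id                                      ∎

    φ-mult : φ ∘ (φ #₁ id) ≡ φ ∘ m Φ Φ
    φ-mult = begin
      (out⁻¹ ∘ m Φ X ∘ (out #₁ id)) ∘ (φ #₁ id)            ≡⟨ pullʳ (pullʳ #-mergeˡ) ⟩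
      out⁻¹ ∘ m Φ X ∘ ((out ∘ φ) #₁ id)                    ≡⟨ refl⟩∘⟨ refl⟩∘⟨ (out∘φ ⟩#⟨ refl) ⟩
      out⁻¹ ∘ m Φ X ∘ ((m Φ X ∘ (out #₁ id)) #₁ id)        ≡⟨ refl⟩∘⟨ refl⟩∘⟨ sym #-mergeˡ ⟩
      out⁻¹ ∘ m Φ X ∘ (m Φ X #₁ id) ∘ ((out #₁ id) #₁ id)  ≡⟨ refl⟩∘⟨ pullˡ m-assoc ⟩
      out⁻¹ ∘ (m Φ X ∘ m Φ (X # Φ)) ∘ ((out #₁ id) #₁ id)  ≡⟨ refl⟩∘⟨ pullʳ (sym (m-natural out)) ⟩
      out⁻¹ ∘ m Φ X ∘ (out #₁ id) ∘ m Φ Φ                  ≡⟨ trans (refl⟩∘⟨ sym assoc) (sym assoc) ⟩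
      φ ∘ m Φ Φ                                            ∎

    -- The solution of e is the restriction to Y of the unique coalgebra map from out ■ e,
    -- the coalgebra that runs e and continues along out once e yields a Φ.
    _† : Hom Y (Φ # Y) → Hom Y Φ
    e † = ⟦ out ■ e ⟧ ∘ inr

    ⟦out■e⟧∘inl : (e : Hom Y (Φ # Y)) → ⟦ out ■ e ⟧ ∘ inl ≡ id
    ⟦out■e⟧∘inl e = endo≡id _ (begin
      out ∘ ⟦ out ■ e ⟧ ∘ inl                  ≡⟨ pullˡ (⟦⟧-hom (out ■ e)) ⟩
      ((id #₁ ⟦ out ■ e ⟧) ∘ (out ■ e)) ∘ inl  ≡⟨ pullʳ (■-inl out e) ⟩
      (id #₁ ⟦ out ■ e ⟧) ∘ (id #₁ inl) ∘ out  ≡⟨ pullˡ #-mergeʳ ⟩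
      (id #₁ (⟦ out ■ e ⟧ ∘ inl)) ∘ out        ∎)

    out∘φ-step : (s : Hom Y Φ) (e : Hom Y (Φ # Y)) →
                 out ∘ φ ∘ (id #₁ s) ∘ e ≡ m Φ X ∘ (out #₁ s) ∘ e
    out∘φ-step s e = trans (pullˡ out∘φ) (pullʳ (pullˡ (sym #-splitˡ)))

    solution : (e : Hom Y (Φ # Y)) → e † ≡ φ ∘ (id #₁ (e †)) ∘ e
    solution e = leftInverse⇒mono out⁻¹∘out (begin
      out ∘ ⟦ out ■ e ⟧ ∘ inr
        ≡⟨ pullˡ (⟦⟧-hom (out ■ e)) ⟩
      ((id #₁ ⟦ out ■ e ⟧) ∘ (out ■ e)) ∘ inr
        ≡⟨ assoc ⟩
      (id #₁ ⟦ out ■ e ⟧) ∘ (out ■ e) ∘ inr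
        ≡⟨ ■-inr out e _ ⟩
      m Φ X ∘ (((id #₁ (⟦ out ■ e ⟧ ∘ inl)) ∘ out) #₁ (e †)) ∘ e
        ≡⟨ refl⟩∘⟨ (trans ((refl ⟩#⟨ ⟦out■e⟧∘inl e) ⟩∘⟨refl) #-identity∘ ⟩#⟨ refl) ⟩∘⟨refl ⟩
      m Φ X ∘ (out #₁ (e †)) ∘ e
        ≡⟨ out∘φ-step (e †) e ⟨
      out ∘ φ ∘ (id #₁ (e †)) ∘ e
        ∎)

    †-unique : (e : Hom Y (Φ # Y)) (s : Hom Y Φ) → s ≡ φ ∘ (id #₁ s) ∘ e → s ≡ e †
    †-unique e s eq = begin
      s                        ≡⟨ inr-β ⟨
      [ id , s ] ∘ inr         ≡⟨ ⟦⟧-unique (out ■ e) [ id , s ] (■-copair out e s iterate) ⟩∘⟨refl ⟩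
      ⟦ out ■ e ⟧ ∘ inr        ∎
      where
      iterate : out ∘ s ≡ m Φ X ∘ (out #₁ s) ∘ e
      iterate = trans (refl⟩∘⟨ eq) (out∘φ-step s e)

    functoriality : (e : Hom Y (Φ # Y)) (f : Hom Z (Φ # Z)) (h : Hom Y Z) →
                    IsCoalgebraHom e f h → (f †) ∘ h ≡ e †
    functoriality e f h hom = †-unique e _ (begin
      (f †) ∘ h                            ≡⟨ solution f ⟩∘⟨refl ⟩
      (φ ∘ (id #₁ (f †)) ∘ f) ∘ h          ≡⟨ pullʳ (pullʳ hom) ⟩
      φ ∘ (id #₁ (f †)) ∘ (id #₁ h) ∘ e    ≡⟨ refl⟩∘⟨ pullˡ #-mergeʳ ⟩
      φ ∘ (id #₁ ((f †) ∘ h)) ∘ e          ∎)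

    compositionality : (f : Hom Y (Φ # Y)) (g : Hom Z (Y # Z)) →
                       ((f ■ g) †) ∘ inr ≡ (((f †) #₁ id) ∘ g) †
    compositionality f g = †-unique _ _ (begin
      s ∘ inr
        ≡⟨ solution (f ■ g) ⟩∘⟨refl ⟩
      (φ ∘ (id #₁ s) ∘ (f ■ g)) ∘ inr
        ≡⟨ pullʳ assoc ⟩
      φ ∘ (id #₁ s) ∘ (f ■ g) ∘ inr
        ≡⟨ refl⟩∘⟨ ■-inr f g s ⟩
      φ ∘ m Φ Φ ∘ (((id #₁ (s ∘ inl)) ∘ f) #₁ (s ∘ inr)) ∘ g
        ≡⟨ pullˡ (sym φ-mult) ⟩
      (φ ∘ (φ #₁ id)) ∘ (((id #₁ (s ∘ inl)) ∘ f) #₁ (s ∘ inr)) ∘ g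
        ≡⟨ pullʳ (pullˡ (trans #-merge (refl ⟩#⟨ identityˡ))) ⟩
      φ ∘ ((φ ∘ (id #₁ (s ∘ inl)) ∘ f) #₁ (s ∘ inr)) ∘ g
        ≡⟨ refl⟩∘⟨ (trans (refl⟩∘⟨ (refl ⟩#⟨ s∘inl) ⟩∘⟨refl) (sym (solution f)) ⟩#⟨ refl) ⟩∘⟨refl ⟩
      φ ∘ ((f †) #₁ (s ∘ inr)) ∘ g
        ≡⟨ refl⟩∘⟨ trans (#-splitʳ ⟩∘⟨refl) assoc ⟩
      φ ∘ (id #₁ (s ∘ inr)) ∘ ((f †) #₁ id) ∘ g
        ∎)
      where
      s = (f ■ g) †
      s∘inl : s ∘ inl ≡ f †
      s∘inl = functoriality f (f ■ g) inl (■-inl f g)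

    isCompleteElgot : IsCompleteElgot Φ φ
    isCompleteElgot = record
      { isAlgebra = record { alg-unit = φ-unit ; alg-mult = φ-mult }
      ; _† = _†
      ; solution = solution
      ; functoriality = functoriality
      ; compositionality = compositionality
      }

    algebra : CompleteElgotAlgebra
    algebra = cea Φ φ isCompleteElgot

    η : Hom X Φ
    η = out⁻¹ ∘ u Φ X

    -- φ ∘ (η # id) = out⁻¹, so the iteration of (η # id) ∘ out is the identity.
    id≡† : id ≡ ((η #₁ id) ∘ out) †
    id≡† = †-unique _ id (sym (begin
      φ ∘ (id #₁ id) ∘ (η #₁ id) ∘ out
        ≡⟨ refl⟩∘⟨ #-identity∘ ⟩
      (out⁻¹ ∘ m Φ X ∘ (out #₁ id)) ∘ (η #₁ id) ∘ out
        ≡⟨ pullʳ (pullʳ (pullˡ #-mergeˡ)) ⟩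
      out⁻¹ ∘ m Φ X ∘ ((out ∘ η) #₁ id) ∘ out
        ≡⟨ refl⟩∘⟨ refl⟩∘⟨ (cancelˡ out∘out⁻¹ ⟩#⟨ refl) ⟩∘⟨refl ⟩
      out⁻¹ ∘ m Φ X ∘ (u Φ X #₁ id) ∘ out
        ≡⟨ refl⟩∘⟨ cancelˡ m-identityʳ ⟩
      out⁻¹ ∘ out
        ≡⟨ out⁻¹∘out ⟩
      id
        ∎))

    isFree : IsFreeCEA X algebra η
    isFree B g = ĝ , ĝ-isCEAMorphism , ĝ∘η , ĝ-unique
      where
      module B = CompleteElgotAlgebra B

      ĝ : Hom Φ B.Carrier
      ĝ = ((g #₁ id) ∘ out) B.†

      ĝ∘⟦⟧ : (c : Hom D (X # D)) → ĝ ∘ ⟦ c ⟧ ≡ ((g #₁ id) ∘ c) B.†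
      ĝ∘⟦⟧ c = B.functoriality _ _ ⟦ c ⟧ (relabel-coalgebraHom g (⟦⟧-hom c))

      ĝ-isCEAMorphism : IsCEAMorphism algebra B ĝ
      ĝ-isCEAMorphism e = begin
        ((ĝ #₁ id) ∘ e) B.†                 ≡⟨ B.compositionality _ e ⟨
        ((((g #₁ id) ∘ out) ■ e) B.†) ∘ inr  ≡⟨ cong B._† (■-natural g out e) ⟩∘⟨refl ⟨
        (((g #₁ id) ∘ (out ■ e)) B.†) ∘ inr  ≡⟨ ĝ∘⟦⟧ (out ■ e) ⟩∘⟨refl ⟨
        (ĝ ∘ ⟦ out ■ e ⟧) ∘ inr              ≡⟨ assoc ⟩
        ĝ ∘ (e †)                            ∎

      ĝ∘η : ĝ ∘ η ≡ g
      ĝ∘η = begin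
        ĝ ∘ out⁻¹ ∘ u Φ X
          ≡⟨ B.solution _ ⟩∘⟨refl ⟩
        (B.structure ∘ (id #₁ ĝ) ∘ (g #₁ id) ∘ out) ∘ out⁻¹ ∘ u Φ X
          ≡⟨ pullʳ (pullʳ (pullʳ (cancelˡ out∘out⁻¹))) ⟩
        B.structure ∘ (id #₁ ĝ) ∘ (g #₁ id) ∘ u Φ X
          ≡⟨ refl⟩∘⟨ pullˡ (sym #-swap) ⟩
        B.structure ∘ ((g #₁ id) ∘ (id #₁ ĝ)) ∘ u Φ X
          ≡⟨ refl⟩∘⟨ pullʳ (mm-unit ĝ) ⟩
        B.structure ∘ (g #₁ id) ∘ u B.Carrier X
          ≡⟨ refl⟩∘⟨ u-natural g ⟩
        B.structure ∘ u B.Carrier B.Carrier ∘ g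
          ≡⟨ cancelˡ (IsAlgebra.alg-unit B.isAlgebra) ⟩
        g
          ∎

      ĝ-unique : (h : Hom Φ B.Carrier) → IsCEAMorphism algebra B h → h ∘ η ≡ g → h ≡ ĝ
      ĝ-unique h h-mor h∘η = begin
        h                                        ≡⟨ identityʳ ⟨
        h ∘ id                                   ≡⟨ refl⟩∘⟨ id≡† ⟩
        h ∘ (((η #₁ id) ∘ out) †)                ≡⟨ h-mor _ ⟨
        ((h #₁ id) ∘ (η #₁ id) ∘ out) B.†        ≡⟨ cong B._† (pullˡ (trans #-mergeˡ (h∘η ⟩#⟨ refl))) ⟩
        ĝ                                        ∎

  module FreeAlgebra (X FX : Obj) (φ : Hom (FX # FX) FX) (E : IsCompleteElgot FX φ) (η : Hom X FX)
                     (free : IsFreeCEA X (cea FX φ E) η) where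
    open IsCompleteElgot E
    open IsAlgebra isAlgebra
    open Lifted E η using (ψ; ψ∘u; ψ-isCEAMorphism) renaming (algebra to X#FX)

    FX-algebra : CompleteElgotAlgebra
    FX-algebra = cea FX φ E

    i : Hom FX (X # FX)
    i = proj₁ (free X#FX (u FX X))

    i-isCEAMorphism : IsCEAMorphism FX-algebra X#FX i
    i-isCEAMorphism = proj₁ (proj₂ (free X#FX (u FX X)))

    i∘η : i ∘ η ≡ u FX X
    i∘η = proj₁ (proj₂ (proj₂ (free X#FX (u FX X))))

    ψ∘i : ψ ∘ i ≡ id
    ψ∘i = free-endo≡id FX-algebra free (ψ ∘ i)
      (∘-isCEAMorphism FX-algebra X#FX FX-algebra i-isCEAMorphism ψ-isCEAMorphism)
      (trans assoc (trans (refl⟩∘⟨ i∘η) ψ∘u))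

    i∘ψ : i ∘ ψ ≡ id
    i∘ψ = begin
      i ∘ φ ∘ (η #₁ id)
        ≡⟨ pullˡ (isCEAMorphism⇒algebraHom E X#FX i i-isCEAMorphism) ⟩
      ((m FX X ∘ (id #₁ ψ)) ∘ (i #₁ i)) ∘ (η #₁ id)
        ≡⟨ trans (pullʳ #-merge) (pullʳ #-merge) ⟩
      m FX X ∘ ((id ∘ i ∘ η) #₁ (ψ ∘ i ∘ id))
        ≡⟨ refl⟩∘⟨ (trans identityˡ i∘η ⟩#⟨ trans (refl⟩∘⟨ identityʳ) ψ∘i) ⟩
      m FX X ∘ (u FX X #₁ id)
        ≡⟨ m-identityʳ ⟩
      id
        ∎

    i∘† : (e : Hom Y (FX # Y)) → i ∘ (e †) ≡ m FX X ∘ (i #₁ (e †)) ∘ e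
    i∘† e = begin
      i ∘ (e †)
        ≡⟨ i-isCEAMorphism e ⟨
      m FX X ∘ (id #₁ (((ψ #₁ id) ∘ (i #₁ id) ∘ e) †)) ∘ (i #₁ id) ∘ e
        ≡⟨ refl⟩∘⟨ (refl ⟩#⟨ cong _† ψi-image) ⟩∘⟨refl ⟩
      m FX X ∘ (id #₁ (e †)) ∘ (i #₁ id) ∘ e
        ≡⟨ refl⟩∘⟨ pullˡ (sym #-splitʳ) ⟩
      m FX X ∘ (i #₁ (e †)) ∘ e
        ∎
      where
      ψi-image : (ψ #₁ id) ∘ (i #₁ id) ∘ e ≡ e
      ψi-image = trans (pullˡ (trans #-mergeˡ (ψ∘i ⟩#⟨ refl))) (trans (#-id ⟩∘⟨refl) identityˡ)

    unfold : Hom FX (FX # FX)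
    unfold = (η #₁ id) ∘ i

    unfold-iterate : (e : Hom Y (FX # Y)) → unfold ∘ (e †) ≡ m FX FX ∘ (unfold #₁ (e †)) ∘ e
    unfold-iterate e = begin
      ((η #₁ id) ∘ i) ∘ (e †)
        ≡⟨ pullʳ (i∘† e) ⟩
      (η #₁ id) ∘ m FX X ∘ (i #₁ (e †)) ∘ e
        ≡⟨ pullˡ (m-natural η) ⟩
      (m FX FX ∘ ((η #₁ id) #₁ id)) ∘ (i #₁ (e †)) ∘ e
        ≡⟨ pullʳ (pullˡ (trans #-merge (refl ⟩#⟨ identityˡ))) ⟩
      m FX FX ∘ (unfold #₁ (e †)) ∘ e
        ∎

    unfold†∘η : (unfold †) ∘ η ≡ η
    unfold†∘η = begin
      (unfold †) ∘ η                                   ≡⟨ solution unfold ⟩∘⟨refl ⟩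
      (φ ∘ (id #₁ (unfold †)) ∘ (η #₁ id) ∘ i) ∘ η     ≡⟨ pullʳ (pullʳ (pullʳ i∘η)) ⟩
      φ ∘ (id #₁ (unfold †)) ∘ (η #₁ id) ∘ u FX X      ≡⟨ refl⟩∘⟨ refl⟩∘⟨ u-natural η ⟩
      φ ∘ (id #₁ (unfold †)) ∘ u FX FX ∘ η             ≡⟨ refl⟩∘⟨ pullˡ (mm-unit (unfold †)) ⟩
      φ ∘ u FX FX ∘ η                                  ≡⟨ cancelˡ alg-unit ⟩
      η                                                ∎

    unfold†≡id : unfold † ≡ id
    unfold†≡id = free-endo≡id FX-algebra free (unfold †)
      (CompleteElgotFacts.†-endomorphism E unfold unfold-iterate) unfold†∘η

    isFinal : IsFinalCoalgebra X FX i
    isFinal {D} c = ⟦c⟧ , ⟦c⟧-hom , ⟦c⟧-unique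
      where
      ⟦c⟧ : Hom D FX
      ⟦c⟧ = ((η #₁ id) ∘ c) †

      ⟦c⟧-hom : IsCoalgebraHom c i ⟦c⟧
      ⟦c⟧-hom = begin
        i ∘ ⟦c⟧                               ≡⟨ refl⟩∘⟨ solution _ ⟩
        i ∘ φ ∘ (id #₁ ⟦c⟧) ∘ (η #₁ id) ∘ c   ≡⟨ refl⟩∘⟨ refl⟩∘⟨ pullˡ (sym #-swap) ⟩
        i ∘ φ ∘ ((η #₁ id) ∘ (id #₁ ⟦c⟧)) ∘ c ≡⟨ refl⟩∘⟨ trans (refl⟩∘⟨ assoc) (sym assoc) ⟩
        i ∘ ψ ∘ (id #₁ ⟦c⟧) ∘ c               ≡⟨ cancelˡ i∘ψ ⟩
        (id #₁ ⟦c⟧) ∘ c                       ∎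

      ⟦c⟧-unique : (h : Hom D FX) → IsCoalgebraHom c i h → h ≡ ⟦c⟧
      ⟦c⟧-unique h hom = begin
        h                  ≡⟨ identityˡ ⟨
        id ∘ h             ≡⟨ unfold†≡id ⟩∘⟨refl ⟨
        (unfold †) ∘ h     ≡⟨ functoriality _ unfold h (relabel-coalgebraHom η hom) ⟩
        ⟦c⟧                ∎

theorem4p14 : ∀ {o ℓ} (C : Category o ℓ) (CP : FiniteCoproducts C) (P : ParametrizedMonad C) →
    let open Category C
        open ParametrizedMonad P
        open Theory C CP P
    in
    -- (i)
    (∀ (X Φ : Obj) (out : Hom Φ (X # Φ)) (out⁻¹ : Hom (X # Φ) Φ) →
      out⁻¹ ∘ out ≡ id → out ∘ out⁻¹ ≡ id → IsFinalCoalgebra X Φ out →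
      Σ (IsCompleteElgot Φ (out⁻¹ ∘ m Φ X ∘ (out #₁ id))) λ E →
        IsFreeCEA X (cea Φ (out⁻¹ ∘ m Φ X ∘ (out #₁ id)) E) (out⁻¹ ∘ u Φ X))
    ×
    -- (ii)
    (∀ (X FX : Obj) (φ : Hom (FX # FX) FX) (E : IsCompleteElgot FX φ) (η : Hom X FX) →
      IsFreeCEA X (cea FX φ E) η →
      Σ (Hom FX (X # FX)) λ i →
        i ∘ (φ ∘ (η #₁ id)) ≡ id × (φ ∘ (η #₁ id)) ∘ i ≡ id × IsFinalCoalgebra X FX i)
theorem4p14 C CP P =
  (λ X Φ out out⁻¹ out⁻¹∘out out∘out⁻¹ final →
    let open FinalCoalgebra X Φ out out⁻¹ out⁻¹∘out out∘out⁻¹ final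
    in isCompleteElgot , isFree) ,
  (λ X FX φ E η free →
    let open FreeAlgebra X FX φ E η free
    in i , i∘ψ , ψ∘i , isFinal)
  where open Elgot C CP P
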